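{- Let $M=(S,A,X,T,i)$ be a parametric MDP, let $M'$ be its induced POMDP, and let $f\colon \mathrm{Hist}_X\to\mathrm{Hist}'$ be the bijection $f(x, s_0\cdot a_0\cdots s_n) = (s_0,x)\cdot a_0\cdots (s_n,x)$ (all defined in the context). Then $\Phi(\pi_X) = \pi_X\circ f^{ -1}$ defines a bijection $\Phi$ from the set of policies of the pMDP $M$ onto the set of policies of the POMDP $M'$, whose inverse is given by $\Phi^{ -1}(\pi') = \pi'\circ f$.
   Context: A (discrete) probability distribution on a set $Y$ is a function $\mu\colon Y\to[0,1]$ with $\sum_{y\in Y}\mu(y)=1$; $\mathrm{Dist}(Y)$ denotes the set of these, and $\delta_y$ is the Dirac distribution at $y$. An MDP is a tuple $(S,A,T,i)$ with state set $S$, action set $A$, transition function $T\colon S\times A\to \mathrm{Dist}(S)$ and initial distribution $i\in\mathrm{Dist}(S)$. A run is an infinite sequence $s_0,a_0,s_1,a_1,\dots$ with $T(s_j,a_j)(s_{j+1})>0$ for all $j$; a history is a finite prefix of a run ending in a state. A policy of an MDP is a map from the set of histories to $\mathrm{Dist}(A)$. A parametric MDP (pMDP) is a tuple $M=(S,A,X,T,i)$ where $S,A,i$ are as for MDPs, $X$ is a set (the parameter space), and $T\colon S\times A\to \mathrm{Dist}(S)^X$; for $x\in X$, $M(x)$ is the MDP $(S,A,T_x,i)$ with $T_x(s,a)=T(s,a)(x)$. Let $\mathrm{Hist}_X=\{(x,h)\mid x\in X,\ h \text{ a history of } M(x)\}$. A policy of the pMDP $M$ is a map $\pi_X\colon \mathrm{Hist}_X\to\mathrm{Dist}(A)$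 that is independent of the parameter: $\pi_X(x,h)=\pi_X(y,h)$ whenever $x,y\in X$ and $h$ is a history of both $M(x)$ and $M(y)$. The induced POMDP of $M$ is the POMDP $M'$ with state set $S\times X$, action set $A$, transition function $T'((s,x),a)(s',x') = T(s,a)(x)(s')\cdot\delta_x(x')$, observation set $S$ and observation function $O(s,x)=s$; $\mathrm{Hist}'$ denotes the set of histories of its underlying MDP $(S\times X,A,T')$. The observation function extends to histories by $O((t_0)\cdot a_0\cdot t_1\cdots t_n) = O(t_0)\cdot a_0\cdot O(t_1)\cdots O(t_n)$. A policy of the POMDP $M'$ is a map $\pi'\colon\mathrm{Hist}'\to\mathrm{Dist}(A)$ such that $\pi'(h)=\pi'(h')$ whenever $O(h)=O(h')$. -}

module Defs where

open import Data.Product using (Σ; _×_; _,_; proj₁; proj₂)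
open import Data.Unit using (⊤; tt)
open import Relation.Binary.PropositionalEquality using (_≡_; refl; subst; sym)

-- Parametric MDP, presented through the data that histories/policies depend on.
-- Pos s a x s'  stands for the proposition  T(s,a)(x)(s') > 0.
-- (The initial distribution i plays no role in histories or policies.)
record PMDP : Set₁ where
  field
    S   : Set
    A   : Set
    X   : Set
    Pos : S → A → X → S → Set

data Raw (A T : Set) : Set where
  start : T → Raw A T
  _▹_▹_ : Raw A T → A → T → Raw A T

last : ∀ {A T} → Raw A T → T
last (start t)   = t
last (h ▹ a ▹ t) = t

mapRaw : ∀ {A T U} → (T → U) → Raw A T → Raw A U
mapRaw g (start t)   = start (g t)
mapRaw g (h ▹ a ▹ t) = mapRaw g h ▹ a ▹ g t

last-map : ∀ {A T U} (g : T → U) (h : Raw A T) → last (mapRaw g h) ≡ g (last h)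
last-map g (start t)   = refl
last-map g (h ▹ a ▹ t) = refl

module _ (M : PMDP) where
  open PMDP M

  -- h is a history of the MDP M(x)
  ValidX : X → Raw A S → Set
  ValidX x (start s)   = ⊤
  ValidX x (h ▹ a ▹ s) = ValidX x h × Pos (last h) a x s

  -- support of the induced POMDP's transition function:
  -- T'((s,x),a)(s',x') = T(s,a)(x)(s') · δ_x(x') > 0  iff  T(s,a)(x)(s') > 0 and x' = x
  Pos' : S × X → A → S × X → Set
  Pos' (s , x) a (s' , x') = Pos s a x s' × x ≡ x'

  -- h is a history of the underlying MDP (S × X, A, T') of M'
  Valid' : Raw A (S × X) → Set
  Valid' (start t)   = ⊤
  Valid' (h ▹ a ▹ t) = Valid' h × Pos' (last h) a t

  Obs : Raw A (S × X) → Raw A S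
  Obs = mapRaw proj₁

  f : X → Raw A S → Raw A (S × X)
  f x = mapRaw (λ s → (s , x))

  f-valid : (x : X) (h : Raw A S) → ValidX x h → Valid' (f x h)
  f-valid x (start s)   v       = tt
  f-valid x (h ▹ a ▹ s) (v , p) =
    f-valid x h v , subst (λ t → Pos' t a (s , x)) (sym (last-map (λ s → (s , x)) h)) (p , refl)

  xOf : Raw A (S × X) → X
  xOf h = proj₂ (last h)

  finv-valid : (h : Raw A (S × X)) → Valid' h → ValidX (xOf h) (Obs h)
  finv-valid (start t) v = tt
  finv-valid (h ▹ a ▹ (s' , x')) (v , p) = helper (last h) refl p
    where
      helper : (t : S × X) → last h ≡ t → Pos' t a (s' , x') → ValidX x' (Obs h) × Pos (last (Obs h)) a x' s'
      helper (s , x) e (q , refl) =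
        subst (λ y → ValidX y (Obs h)) (cong₂' e) (finv-valid h v) ,
        subst (λ u → Pos u a x s') (sym (trans' (last-map proj₁ h) e)) q
        where
          cong₂' : last h ≡ (s , x) → xOf h ≡ x
          cong₂' e rewrite e = refl
          trans' : last (Obs h) ≡ proj₁ (last h) → last h ≡ (s , x) → last (Obs h) ≡ s
          trans' e1 e2 rewrite e2 = e1

  finv : (h : Raw A (S × X)) → Valid' h → Σ X (λ x → Σ (Raw A S) (ValidX x))
  finv h v = xOf h , Obs h , finv-valid h v

  module _ (D : Set) where
    -- D plays the role of Dist(A), the codomain of policies.

    FunX : Set
    FunX = (x : X) (h : Raw A S) → ValidX x h → D

    IsPolicyX : FunX → Set
    IsPolicyX π = ∀ x y h (v : ValidX x h) (w : ValidX y h) → π x h v ≡ π y h w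

    PolicyX : Set
    PolicyX = Σ FunX IsPolicyX

    Fun' : Set
    Fun' = (h : Raw A (S × X)) → Valid' h → D

    IsPolicy' : Fun' → Set
    IsPolicy' π = ∀ h h' (v : Valid' h) (v' : Valid' h') → Obs h ≡ Obs h' → π h v ≡ π h' v'

    Policy' : Set
    Policy' = Σ Fun' IsPolicy'

    Φ : FunX → Fun'
    Φ π h v = π (proj₁ (finv h v)) (proj₁ (proj₂ (finv h v))) (proj₂ (proj₂ (finv h v)))

    Ψ : Fun' → FunX
    Ψ π x h v = π (f x h) (f-valid x h v)

-- Projecting away the parameter undoes f, so every composite that arises here can be
-- compared through observations alone: a pMDP policy only sees the observed history
-- (it ignores the parameter), and a POMDP policy is by definition constant on
-- histories with equal observations. In particular Φ (Ψ π') agrees with π' without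
-- ever reconstructing a history of M' from its observation and parameter.
module Submission where

open import Defs
open import Data.Product using (_×_; _,_)
open import Relation.Binary.PropositionalEquality using (_≡_; refl; cong; cong₂; sym; trans)

mapRaw-inverseˡ : ∀ {A T U} {g : U → T} {k : T → U} →
                  (∀ t → g (k t) ≡ t) → (h : Raw A T) → mapRaw g (mapRaw k h) ≡ h
mapRaw-inverseˡ g∘k≗id (start t)   = cong start (g∘k≗id t)
mapRaw-inverseˡ g∘k≗id (h ▹ a ▹ t) =
  cong₂ (_▹ a ▹_) (mapRaw-inverseˡ g∘k≗id h) (g∘k≗id t)

module _ (M : PMDP) where
  open PMDP M

  Obs∘f : (x : X) (h : Raw A S) → Obs M (f M x h) ≡ h
  Obs∘f x = mapRaw-inverseˡ (λ _ → refl)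

  module _ (D : Set) where

    policyX-cong : {π : FunX M D} → IsPolicyX M D π →
                   ∀ {x y h h′} (v : ValidX M x h) (w : ValidX M y h′) → h ≡ h′ → π x h v ≡ π y h′ w
    policyX-cong isPolicy v w refl = isPolicy _ _ _ v w

    Φ-policy : (π : FunX M D) → IsPolicyX M D π → IsPolicy' M D (Φ M D π)
    Φ-policy π isPolicy _ _ _ _ = policyX-cong isPolicy _ _

    Ψ-policy : (π′ : Fun' M D) → IsPolicy' M D π′ → IsPolicyX M D (Ψ M D π′)
    Ψ-policy π′ isPolicy x y h v w = isPolicy _ _ _ _ (trans (Obs∘f x h) (sym (Obs∘f y h)))

    Ψ∘Φ : (π : FunX M D) → IsPolicyX M D π →
          ∀ x h (v : ValidX M x h) → Ψ M D (Φ M D π) x h v ≡ π x h v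
    Ψ∘Φ π isPolicy x h v = policyX-cong isPolicy _ v (Obs∘f x h)

    Φ∘Ψ : (π′ : Fun' M D) → IsPolicy' M D π′ →
          ∀ h (v : Valid' M h) → Φ M D (Ψ M D π′) h v ≡ π′ h v
    Φ∘Ψ π′ isPolicy h v = isPolicy _ h _ v (Obs∘f _ (Obs M h))

lemma2 : (M : PMDP) (D : Set) →
    ((π : FunX M D) → IsPolicyX M D π → IsPolicy' M D (Φ M D π))
    × ((π' : Fun' M D) → IsPolicy' M D π' → IsPolicyX M D (Ψ M D π'))
    × ((π : FunX M D) → IsPolicyX M D π →
         ∀ x h (v : ValidX M x h) → Ψ M D (Φ M D π) x h v ≡ π x h v)
    × ((π' : Fun' M D) → IsPolicy' M D π' →
         ∀ h (v : Valid' M h) → Φ M D (Ψ M D π') h v ≡ π' h v)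
lemma2 M D = Φ-policy M D , Ψ-policy M D , Ψ∘Φ M D , Φ∘Ψ M D
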